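{- A perfect cuboid exists if and only if there exist rational numbers $\alpha_1,\beta_1,\gamma_1\in\mathbb{Q}\setminus\{0,1,-1\}$ satisfying $$\Big(\frac{2\alpha_1}{1+\alpha_1^2}\Big)^2+\Big(\frac{2\gamma_1}{1+\gamma_1^2}\Big)^2=\Big(\frac{2\beta_1}{1+\beta_1^2}\Big)^2.$$
   Context: A perfect cuboid is a triple of positive rational numbers $a,b,c$ such that $a^2+b^2$, $b^2+c^2$, $a^2+c^2$ and $a^2+b^2+c^2$ are all squares of rational numbers. -}

module Defs where

open import Data.Integer.Base using (+_; -[1+_])
open import Data.Rational.Base
open import Data.Rational.Properties
  using (nonNeg*nonNeg⇒nonNeg; nonPos*nonPos⇒nonPos; pos+nonNeg⇒pos; pos⇒nonZero)
open import Data.Product using (∃; _×_)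
open import Relation.Binary.PropositionalEquality using (_≡_)

IsSquare : ℚ → Set
IsSquare q = ∃ λ r → r * r ≡ q

PerfectCuboid : ℚ → ℚ → ℚ → Set
PerfectCuboid a b c =
  Positive a × Positive b × Positive c ×
  IsSquare (a * a + b * b) × IsSquare (b * b + c * c) ×
  IsSquare (a * a + c * c) × IsSquare (a * a + b * b + c * c)

sq-nonNeg : ∀ p → NonNegative (p * p)
sq-nonNeg p@(mkℚ (+ _) _ _) = nonNeg*nonNeg⇒nonNeg p p
sq-nonNeg p@(mkℚ -[1+ _ ] _ _) = nonPos*nonPos⇒nonPos p p

1+sq-nonZero : ∀ α → NonZero (1ℚ + α * α)
1+sq-nonZero α = pos⇒nonZero (1ℚ + α * α) {{pos+nonNeg⇒pos 1ℚ (α * α) {{sq-nonNeg α}}}}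

s : ℚ → ℚ
s α = (2ℚ * α) ÷ (1ℚ + α * α)
  where instance _ = 1+sq-nonZero α
        2ℚ = 1ℚ + 1ℚ

{-# OPTIONS --safe #-}
module Submission where

-- With t α = (1 - α²)/(1 + α²) we have s α² + t α² = 1, and α = x/(E + F),
-- the tangent of the half angle of a Pythagorean triple F² + x² = E², has
-- s α = x/E.  Scaling a perfect cuboid by its space diagonal E, the edges
-- c, b and the face diagonal of b, c become s α, s γ, s β, whence
-- s α² + s γ² = s β².  Conversely t β, s γ, s α are the edges of a cuboid
-- with face diagonals t α, s β, t γ and space diagonal 1.

open import Defs
open import Data.Rational.Base
  using (ℚ; 0ℚ; 1ℚ; -_; _+_; _-_; _*_; _÷_; 1/_; ∣_∣; NonZero; Positive; ≢-nonZero)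
open import Data.Rational.Properties
  using (_≟_; +-*-commutativeRing; +-0-group; +-0-commutativeMonoid; heytingCommutativeRing;
         +-assoc; +-comm; *-assoc; *-identityʳ; *-inverseˡ; *-inverseʳ; *-zeroˡ;
         pos+pos⇒pos; pos+nonNeg⇒pos; pos*pos⇒pos; nonNegative⁻¹; nonNeg∧nonZero⇒pos;
         ∣-∣-nonNeg; ∣p∣≡0⇒p≡0; ∣p*q∣≡∣p∣*∣q∣; 0≤p⇒∣p∣≡p)
open import Algebra.Bundles using (CommutativeMonoid)
open import Algebra.Apartness.Properties.HeytingCommutativeRing heytingCommutativeRing
  using (x#0y#0→xy#0)
open import Algebra.Properties.Group +-0-group using (x∙y⁻¹≈ε⇒x≈y; inverseˡ-unique)
open import Algebra.Properties.CommutativeSemigroup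
  (CommutativeMonoid.commutativeSemigroup +-0-commutativeMonoid)
  using (xy∙z≈xz∙y; xy∙z≈zy∙x)
open import Data.List.Base using (_∷_; [])
open import Data.Product using (∃; _×_; _,_)
open import Function.Base using (_∘_)
open import Function.Bundles using (_⇔_; mk⇔)
open import Level using (0ℓ)
open import Relation.Nullary.Decidable using (dec⇒maybe)
open import Relation.Binary.PropositionalEquality
  using (_≡_; _≢_; refl; sym; trans; cong; cong₂; module ≡-Reasoning)
open import Tactic.RingSolver using (solve)
import Tactic.RingSolver.Core.AlmostCommutativeRing as ACR
open ≡-Reasoning

ℚ-ring : ACR.AlmostCommutativeRing 0ℓ 0ℓ
ℚ-ring = ACR.fromCommutativeRing +-*-commutativeRing (λ p → dec⇒maybe (0ℚ ≟ p))

nonZero⇒≢0 : ∀ p → .{{NonZero p}} → p ≢ 0ℚ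
nonZero⇒≢0 _ {{()}} refl

pos⇒≢0 : ∀ p → .{{Positive p}} → p ≢ 0ℚ
pos⇒≢0 _ {{()}} refl

*-cancelʳ-≢0 : ∀ {p q} r → r ≢ 0ℚ → p * r ≡ q * r → p ≡ q
*-cancelʳ-≢0 {p} {q} r r≢0 eq = begin
  p             ≡⟨ sym (*-identityʳ p) ⟩
  p * 1ℚ        ≡⟨ cong (p *_) (sym (*-inverseʳ r)) ⟩
  p * (r * r⁻¹) ≡⟨ sym (*-assoc p r r⁻¹) ⟩
  p * r * r⁻¹   ≡⟨ cong (_* r⁻¹) eq ⟩
  q * r * r⁻¹   ≡⟨ *-assoc q r r⁻¹ ⟩
  q * (r * r⁻¹) ≡⟨ cong (q *_) (*-inverseʳ r) ⟩
  q * 1ℚ        ≡⟨ *-identityʳ q ⟩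
  q             ∎
  where
  instance
    r-nonZero : NonZero r
    r-nonZero = ≢-nonZero r≢0
  r⁻¹ : ℚ
  r⁻¹ = 1/ r

p÷q*q≡p : ∀ p q .{{_ : NonZero q}} → p ÷ q * q ≡ p
p÷q*q≡p p q = begin
  p * 1/ q * q   ≡⟨ *-assoc p (1/ q) q ⟩
  p * (1/ q * q) ≡⟨ cong (p *_) (*-inverseˡ q) ⟩
  p * 1ℚ         ≡⟨ *-identityʳ p ⟩
  p              ∎

∣p∣*∣p∣≡p*p : ∀ p → ∣ p ∣ * ∣ p ∣ ≡ p * p
∣p∣*∣p∣≡p*p p = trans (sym (∣p*q∣≡∣p∣*∣q∣ p p))
                      (0≤p⇒∣p∣≡p (nonNegative⁻¹ (p * p) {{sq-nonNeg p}}))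

≢0⇒∣p∣-pos : ∀ {p} → p ≢ 0ℚ → Positive ∣ p ∣
≢0⇒∣p∣-pos {p} p≢0 =
  nonNeg∧nonZero⇒pos ∣ p ∣ {{∣-∣-nonNeg p}} {{≢-nonZero (p≢0 ∘ ∣p∣≡0⇒p≡0 p)}}

pos+sq-pos : ∀ p q → .{{Positive p}} → Positive (p + q * q)
pos+sq-pos p q = pos+nonNeg⇒pos p (q * q) {{sq-nonNeg q}}

positive-root : ∀ q → .{{Positive q}} → IsSquare q → ∃ λ r → Positive r × r * r ≡ q
positive-root q (r , r*r≡q) = ∣ r ∣ , ≢0⇒∣p∣-pos r≢0 , trans (∣p∣*∣p∣≡p*p r) r*r≡q
  where
  r≢0 : r ≢ 0ℚ
  r≢0 refl = pos⇒≢0 q (sym r*r≡q)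

t : ℚ → ℚ
t α = (1ℚ - α * α) ÷ (1ℚ + α * α)
  where instance _ = 1+sq-nonZero α

1+α²≢0 : ∀ α → 1ℚ + α * α ≢ 0ℚ
1+α²≢0 α = nonZero⇒≢0 (1ℚ + α * α) {{1+sq-nonZero α}}

s*[1+α²] : ∀ α → s α * (1ℚ + α * α) ≡ (1ℚ + 1ℚ) * α
s*[1+α²] α = p÷q*q≡p ((1ℚ + 1ℚ) * α) (1ℚ + α * α) {{1+sq-nonZero α}}

t*[1+α²] : ∀ α → t α * (1ℚ + α * α) ≡ 1ℚ - α * α
t*[1+α²] α = p÷q*q≡p (1ℚ - α * α) (1ℚ + α * α) {{1+sq-nonZero α}}

s²+t²≡1 : ∀ α → s α * s α + t α * t α ≡ 1ℚ
s²+t²≡1 α = *-cancelʳ-≢0 (N * N) (x#0y#0→xy#0 (1+α²≢0 α) (1+α²≢0 α)) (begin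
  (s α * s α + t α * t α) * (N * N)
    ≡⟨ distribute (s α) (t α) N ⟩
  (s α * N) * (s α * N) + (t α * N) * (t α * N)
    ≡⟨ cong₂ (λ u v → u * u + v * v) (s*[1+α²] α) (t*[1+α²] α) ⟩
  ((1ℚ + 1ℚ) * α) * ((1ℚ + 1ℚ) * α) + (1ℚ - α * α) * (1ℚ - α * α)
    ≡⟨ solve (α ∷ []) ℚ-ring ⟩
  1ℚ * ((1ℚ + α * α) * (1ℚ + α * α))
    ∎)
  where
  N : ℚ
  N = 1ℚ + α * α
  distribute : ∀ x y n → (x * x + y * y) * (n * n) ≡ (x * n) * (x * n) + (y * n) * (y * n)
  distribute x y n = solve (x ∷ y ∷ n ∷ []) ℚ-ring

s≢0 : ∀ {α} → α ≢ 0ℚ → s α ≢ 0ℚ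
s≢0 {α} α≢0 sα≡0 = x#0y#0→xy#0 {x = 1ℚ + 1ℚ} (λ ()) α≢0 (begin
  (1ℚ + 1ℚ) * α          ≡⟨ sym (s*[1+α²] α) ⟩
  s α * (1ℚ + α * α)     ≡⟨ cong (_* (1ℚ + α * α)) sα≡0 ⟩
  0ℚ * (1ℚ + α * α)      ≡⟨ *-zeroˡ (1ℚ + α * α) ⟩
  0ℚ                     ∎)

t≢0 : ∀ {α} → α ≢ 1ℚ → α ≢ - 1ℚ → t α ≢ 0ℚ
t≢0 {α} α≢1 α≢-1 tα≡0 = x#0y#0→xy#0 1-α≢0 α+1≢0 (begin
  (1ℚ - α) * (α + 1ℚ)    ≡⟨ solve (α ∷ []) ℚ-ring ⟩
  1ℚ - α * α             ≡⟨ sym (t*[1+α²] α) ⟩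
  t α * (1ℚ + α * α)     ≡⟨ cong (_* (1ℚ + α * α)) tα≡0 ⟩
  0ℚ * (1ℚ + α * α)      ≡⟨ *-zeroˡ (1ℚ + α * α) ⟩
  0ℚ                     ∎)
  where
  1-α≢0 : 1ℚ - α ≢ 0ℚ
  1-α≢0 = α≢1 ∘ sym ∘ x∙y⁻¹≈ε⇒x≈y 1ℚ α
  α+1≢0 : α + 1ℚ ≢ 0ℚ
  α+1≢0 = α≢-1 ∘ inverseˡ-unique α 1ℚ

-- σ stands for s α, abstracted so that the ring solver sees a variable.
half-angle-leg : ∀ σ α D E x → D ≢ 0ℚ → σ * (1ℚ + α * α) ≡ (1ℚ + 1ℚ) * α →
                 α * D ≡ x → D * D + x * x ≡ (1ℚ + 1ℚ) * E * D → σ * E ≡ x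
half-angle-leg σ α D E x D≢0 σ-def α*D≡x D²+x²≡2ED =
  *-cancelʳ-≢0 ((1ℚ + α * α) * (D * D))
    (x#0y#0→xy#0 (1+α²≢0 α) (x#0y#0→xy#0 D≢0 D≢0)) (begin
  σ * E * ((1ℚ + α * α) * (D * D))  ≡⟨ solve (σ ∷ α ∷ D ∷ E ∷ []) ℚ-ring ⟩
  σ * (1ℚ + α * α) * E * D * D      ≡⟨ cong (λ u → u * E * D * D) σ-def ⟩
  (1ℚ + 1ℚ) * α * E * D * D         ≡⟨ solve (α ∷ D ∷ E ∷ []) ℚ-ring ⟩
  (1ℚ + 1ℚ) * (α * D) * E * D       ≡⟨ cong (λ u → (1ℚ + 1ℚ) * u * E * D) α*D≡x ⟩
  (1ℚ + 1ℚ) * x * E * D             ≡⟨ solve (x ∷ D ∷ E ∷ []) ℚ-ring ⟩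
  x * ((1ℚ + 1ℚ) * E * D)           ≡⟨ cong (x *_) (sym D²+x²≡2ED) ⟩
  x * (D * D + x * x)               ≡⟨ cong (λ u → x * (D * D + u * u)) (sym α*D≡x) ⟩
  x * (D * D + (α * D) * (α * D))   ≡⟨ solve (x ∷ α ∷ D ∷ []) ℚ-ring ⟩
  x * ((1ℚ + α * α) * (D * D))      ∎)

pythagorean⇒half-angle : ∀ E F x → F * F + x * x ≡ E * E →
                         (E + F) * (E + F) + x * x ≡ (1ℚ + 1ℚ) * E * (E + F)
pythagorean⇒half-angle E F x pyth = begin
  (E + F) * (E + F) + x * x                   ≡⟨ solve (E ∷ F ∷ x ∷ []) ℚ-ring ⟩
  E * E + (1ℚ + 1ℚ) * E * F + (F * F + x * x) ≡⟨ cong (E * E + (1ℚ + 1ℚ) * E * F +_) pyth ⟩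
  E * E + (1ℚ + 1ℚ) * E * F + E * E           ≡⟨ solve (E ∷ F ∷ []) ℚ-ring ⟩
  (1ℚ + 1ℚ) * E * (E + F)                     ∎

σ²≡1⇒F*F≡0 : ∀ σ E F x → σ * E ≡ x → F * F + x * x ≡ E * E → σ * σ ≡ 1ℚ → F * F ≡ 0ℚ
σ²≡1⇒F*F≡0 σ E F x σ*E≡x pyth σ²≡1 = begin
  F * F                          ≡⟨ solve (F ∷ x ∷ []) ℚ-ring ⟩
  (F * F + x * x) - x * x        ≡⟨ cong (_- x * x) pyth ⟩
  E * E - x * x                  ≡⟨ cong (λ u → E * E - u * u) (sym σ*E≡x) ⟩
  E * E - (σ * E) * (σ * E)      ≡⟨ solve (σ ∷ E ∷ []) ℚ-ring ⟩
  E * E - (σ * σ) * (E * E)      ≡⟨ cong (λ u → E * E - u * (E * E)) σ²≡1 ⟩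
  E * E - 1ℚ * (E * E)           ≡⟨ solve (E ∷ []) ℚ-ring ⟩
  0ℚ                             ∎

Admissible : ℚ → Set
Admissible α = α ≢ 0ℚ × α ≢ 1ℚ × α ≢ - 1ℚ

pythagorean⇒s-leg : ∀ E F x → .{{Positive E}} → .{{Positive F}} → x ≢ 0ℚ →
                    F * F + x * x ≡ E * E → ∃ λ α → Admissible α × s α * E ≡ x
pythagorean⇒s-leg E F x x≢0 pyth = α , (α≢0 , α≢1 , α≢-1) , sα*E≡x
  where
  E+F≢0 : E + F ≢ 0ℚ
  E+F≢0 = pos⇒≢0 (E + F) {{pos+pos⇒pos E F}}
  instance
    E+F-nonZero : NonZero (E + F)
    E+F-nonZero = ≢-nonZero E+F≢0
  α : ℚ
  α = x ÷ (E + F)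
  α*[E+F]≡x : α * (E + F) ≡ x
  α*[E+F]≡x = p÷q*q≡p x (E + F)
  sα*E≡x : s α * E ≡ x
  sα*E≡x = half-angle-leg (s α) α (E + F) E x E+F≢0 (s*[1+α²] α) α*[E+F]≡x
                             (pythagorean⇒half-angle E F x pyth)
  α≢0 : α ≢ 0ℚ
  α≢0 α≡0 = x≢0 (begin
    x             ≡⟨ sym α*[E+F]≡x ⟩
    α * (E + F)   ≡⟨ cong (_* (E + F)) α≡0 ⟩
    0ℚ * (E + F)  ≡⟨ *-zeroˡ (E + F) ⟩
    0ℚ            ∎)
  s²≢1 : s α * s α ≢ 1ℚ
  s²≢1 = x#0y#0→xy#0 (pos⇒≢0 F) (pos⇒≢0 F) ∘ σ²≡1⇒F*F≡0 (s α) E F x sα*E≡x pyth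
  -- s 1ℚ * s 1ℚ and s (- 1ℚ) * s (- 1ℚ) both compute to 1ℚ.
  α≢1 : α ≢ 1ℚ
  α≢1 = s²≢1 ∘ cong (λ a → s a * s a)
  α≢-1 : α ≢ - 1ℚ
  α≢-1 = s²≢1 ∘ cong (λ a → s a * s a)

scaled-pythagorean : ∀ σ τ ρ E {x y z} → E ≢ 0ℚ → σ * E ≡ x → τ * E ≡ y → ρ * E ≡ z →
                     x * x + y * y ≡ z * z → σ * σ + τ * τ ≡ ρ * ρ
scaled-pythagorean σ τ ρ E {x} {y} {z} E≢0 σ*E≡x τ*E≡y ρ*E≡z pyth =
  *-cancelʳ-≢0 (E * E) (x#0y#0→xy#0 E≢0 E≢0) (begin
    (σ * σ + τ * τ) * (E * E)                  ≡⟨ solve (σ ∷ τ ∷ E ∷ []) ℚ-ring ⟩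
    (σ * E) * (σ * E) + (τ * E) * (τ * E)      ≡⟨ cong₂ (λ u v → u * u + v * v) σ*E≡x τ*E≡y ⟩
    x * x + y * y                              ≡⟨ pyth ⟩
    z * z                                      ≡⟨ cong (λ u → u * u) (sym ρ*E≡z) ⟩
    (ρ * E) * (ρ * E)                          ≡⟨ solve (ρ ∷ E ∷ []) ℚ-ring ⟩
    ρ * ρ * (E * E)                            ∎)

HalfAngleSolution : Set
HalfAngleSolution = ∃ λ α → ∃ λ β → ∃ λ γ →
  Admissible α × Admissible β × Admissible γ × s α * s α + s γ * s γ ≡ s β * s β

diagonals⇒halfAngleSolution : ∀ a b c E F G H →
  .{{Positive a}} → .{{Positive b}} → .{{Positive c}} →
  .{{Positive E}} → .{{Positive F}} → .{{Positive G}} → .{{Positive H}} →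
  E * E ≡ a * a + b * b + c * c → F * F ≡ a * a + b * b →
  G * G ≡ a * a + c * c → H * H ≡ b * b + c * c → HalfAngleSolution
diagonals⇒halfAngleSolution a b c E F G H E² F² G² H² =
  combine (pythagorean⇒s-leg E F c (pos⇒≢0 c) F²+c²≡E²)
          (pythagorean⇒s-leg E a H (pos⇒≢0 H) a²+H²≡E²)
          (pythagorean⇒s-leg E G b (pos⇒≢0 b) G²+b²≡E²)
  where
  F²+c²≡E² : F * F + c * c ≡ E * E
  F²+c²≡E² = trans (cong (_+ c * c) F²) (sym E²)
  a²+H²≡E² : a * a + H * H ≡ E * E
  a²+H²≡E² = trans (cong (a * a +_) H²) (trans (sym (+-assoc (a * a) (b * b) (c * c))) (sym E²))
  G²+b²≡E² : G * G + b * b ≡ E * E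
  G²+b²≡E² = trans (cong (_+ b * b) G²) (trans (xy∙z≈xz∙y (a * a) (c * c) (b * b)) (sym E²))
  combine : (∃ λ α → Admissible α × s α * E ≡ c) → (∃ λ β → Admissible β × s β * E ≡ H) →
            (∃ λ γ → Admissible γ × s γ * E ≡ b) → HalfAngleSolution
  combine (α , α-adm , sα*E≡c) (β , β-adm , sβ*E≡H) (γ , γ-adm , sγ*E≡b) =
    α , β , γ , α-adm , β-adm , γ-adm ,
    scaled-pythagorean (s α) (s γ) (s β) E (pos⇒≢0 E) sα*E≡c sγ*E≡b sβ*E≡H
      (trans (+-comm (c * c) (b * b)) (sym H²))

perfectCuboid⇒halfAngleSolution : ∀ a b c → PerfectCuboid a b c → HalfAngleSolution
perfectCuboid⇒halfAngleSolution a b c (pa , pb , pc , ab□ , bc□ , ac□ , abc□) =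
  let E , pE , E² = positive-root _ {{a²+b²+c²>0}} abc□
      F , pF , F² = positive-root _ {{a²+b²>0}} ab□
      G , pG , G² = positive-root _ {{a²+c²>0}} ac□
      H , pH , H² = positive-root _ {{b²+c²>0}} bc□
  in diagonals⇒halfAngleSolution a b c E F G H {{pa}} {{pb}} {{pc}} {{pE}} {{pF}} {{pG}} {{pH}}
       E² F² G² H²
  where
  a²>0 : Positive (a * a)
  a²>0 = pos*pos⇒pos a {{pa}} a {{pa}}
  a²+b²>0 : Positive (a * a + b * b)
  a²+b²>0 = pos+sq-pos (a * a) b {{a²>0}}
  a²+b²+c²>0 : Positive (a * a + b * b + c * c)
  a²+b²+c²>0 = pos+sq-pos (a * a + b * b) c {{a²+b²>0}}
  a²+c²>0 : Positive (a * a + c * c)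
  a²+c²>0 = pos+sq-pos (a * a) c {{a²>0}}
  b²+c²>0 : Positive (b * b + c * c)
  b²+c²>0 = pos+sq-pos (b * b) c {{pos*pos⇒pos b {{pb}} b {{pb}}}}

complement-sum : ∀ A B {A′ B′ C} → A + A′ ≡ 1ℚ → B + B′ ≡ 1ℚ → A + C ≡ B → A′ ≡ B′ + C
complement-sum A B {A′} {B′} {C} A+A′≡1 B+B′≡1 A+C≡B = begin
  A′                  ≡⟨ solve (A ∷ A′ ∷ []) ℚ-ring ⟩
  (A + A′) - A        ≡⟨ cong (_- A) (trans A+A′≡1 (sym B+B′≡1)) ⟩
  (B + B′) - A        ≡⟨ cong (λ u → (u + B′) - A) (sym A+C≡B) ⟩
  (A + C + B′) - A    ≡⟨ solve (A ∷ B′ ∷ C ∷ []) ℚ-ring ⟩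
  B′ + C              ∎

RationalDiagonals : ℚ → ℚ → ℚ → Set
RationalDiagonals a b c =
  IsSquare (a * a + b * b) × IsSquare (b * b + c * c) ×
  IsSquare (a * a + c * c) × IsSquare (a * a + b * b + c * c)

s-relation⇒rationalDiagonals : ∀ α β γ → s α * s α + s γ * s γ ≡ s β * s β →
                               RationalDiagonals (t β) (s γ) (s α)
s-relation⇒rationalDiagonals α β γ rel =
  (t α , complement-sum (s α * s α) (s β * s β) (s²+t²≡1 α) (s²+t²≡1 β) rel) ,
  (s β , trans (sym rel) (+-comm (s α * s α) (s γ * s γ))) ,
  (t γ , complement-sum (s γ * s γ) (s β * s β) (s²+t²≡1 γ) (s²+t²≡1 β)
                        (trans (+-comm (s γ * s γ) (s α * s α)) rel)) ,
  (1ℚ , (begin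
    1ℚ                                       ≡⟨ sym (s²+t²≡1 β) ⟩
    s β * s β + t β * t β                    ≡⟨ cong (_+ t β * t β) (sym rel) ⟩
    s α * s α + s γ * s γ + t β * t β        ≡⟨ xy∙z≈zy∙x (s α * s α) (s γ * s γ) (t β * t β) ⟩
    t β * t β + s γ * s γ + s α * s α        ∎))

rationalDiagonals⇒perfectCuboid-∣∣ : ∀ {a b c} → a ≢ 0ℚ → b ≢ 0ℚ → c ≢ 0ℚ →
  RationalDiagonals a b c → PerfectCuboid (∣ a ∣) (∣ b ∣) (∣ c ∣)
rationalDiagonals⇒perfectCuboid-∣∣ {a} {b} {c} a≢0 b≢0 c≢0 diagonals
  rewrite ∣p∣*∣p∣≡p*p a | ∣p∣*∣p∣≡p*p b | ∣p∣*∣p∣≡p*p c =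
  ≢0⇒∣p∣-pos a≢0 , ≢0⇒∣p∣-pos b≢0 , ≢0⇒∣p∣-pos c≢0 , diagonals

theorem1 : (∃ λ a → ∃ λ b → ∃ λ c → PerfectCuboid a b c)
           ⇔ (∃ λ α₁ → ∃ λ β₁ → ∃ λ γ₁ →
                (α₁ ≢ 0ℚ × α₁ ≢ 1ℚ × α₁ ≢ - 1ℚ) ×
                (β₁ ≢ 0ℚ × β₁ ≢ 1ℚ × β₁ ≢ - 1ℚ) ×
                (γ₁ ≢ 0ℚ × γ₁ ≢ 1ℚ × γ₁ ≢ - 1ℚ) ×
                s α₁ * s α₁ + s γ₁ * s γ₁ ≡ s β₁ * s β₁)
theorem1 = mk⇔ to from
  where
  to : (∃ λ a → ∃ λ b → ∃ λ c → PerfectCuboid a b c) → HalfAngleSolution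
  to (a , b , c , cuboid) = perfectCuboid⇒halfAngleSolution a b c cuboid
  from : HalfAngleSolution → ∃ λ a → ∃ λ b → ∃ λ c → PerfectCuboid a b c
  from (α , β , γ , (α≢0 , _ , _) , (_ , β≢1 , β≢-1) , (γ≢0 , _ , _) , rel) =
    ∣ t β ∣ , ∣ s γ ∣ , ∣ s α ∣ ,
    rationalDiagonals⇒perfectCuboid-∣∣ (t≢0 β≢1 β≢-1) (s≢0 γ≢0) (s≢0 α≢0)
      (s-relation⇒rationalDiagonals α β γ rel)
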